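{- If $\langle A;\cdot,0,\Diamond\rangle$ is a monadic quasi-implication algebra, then $\Diamond\Diamond x=\Diamond x$ for all $x\in A$.
   Context: A quasi-implication algebra is a magma $\langle A;\cdot\rangle$ satisfying, for all $x,y,z\in A$: (1) $(x\cdot y)\cdot x=x$; (2) $(x\cdot y)\cdot(x\cdot z)=(y\cdot x)\cdot(y\cdot z)$; (3) $((x\cdot y)\cdot(y\cdot x))\cdot x=((y\cdot x)\cdot(x\cdot y))\cdot y$. In any quasi-implication algebra $x\cdot x=y\cdot y$ for all $x,y$, and $1$ denotes this common element; the relation $x\preceq y$ iff $x\cdot y=1$ is a partial order. A bounded quasi-implication algebra is a quasi-implication algebra with a distinguished element $0$ such that $0\cdot x=1$ for all $x$. A monadic quasi-implication algebra is an algebra $\langle A;\cdot,0,\Diamond\rangle$ such that $\langle A;\cdot,0\rangle$ is a bounded quasi-implication algebra and $\Diamond\colon A\to A$ satisfies, for all $x,y\in A$: (a) $\Diamond\Diamond x\cdot\Diamond x=1$ and $x\cdot\Diamond x=1$; (b) $\Diamond(\Diamond x\cdot 0)=\Diamond x\cdot 0$ and $\Diamond 0=0$; (c) $\Diamond(((x\cdot 0)\cdot(y\cdot 0))\cdot x)=((\Diamond x\cdot 0)\cdot(\Diamond y\cdot 0))\cdot\Diamond x$. -}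

module Defs where

open import Level using (Level; suc)
open import Relation.Binary.PropositionalEquality using (_≡_)

record IsQuasiImplicationAlgebra {a : Level} (A : Set a) (_·_ : A → A → A) : Set a where
  field
    qi1 : ∀ x y → (x · y) · x ≡ x
    qi2 : ∀ x y z → (x · y) · (x · z) ≡ (y · x) · (y · z)
    qi3 : ∀ x y → ((x · y) · (y · x)) · x ≡ ((y · x) · (x · y)) · y

-- Monadic quasi-implication algebra ⟨A; ·, 0, ◇⟩.
-- The constant 1 is the common value of x · x; we write it as 𝟎 · 𝟎.
record MonadicQIA (a : Level) : Set (suc a) where
  infixl 7 _·_
  field
    Carrier : Set a
    _·_ : Carrier → Carrier → Carrier
    𝟎 : Carrier
    ◇ : Carrier → Carrier
    isQIA : IsQuasiImplicationAlgebra Carrier _·_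

  𝟏 : Carrier
  𝟏 = 𝟎 · 𝟎

  field
    bounded : ∀ x → 𝟎 · x ≡ 𝟏
    ◇-a₁ : ∀ x → ◇ (◇ x) · ◇ x ≡ 𝟏
    ◇-a₂ : ∀ x → x · ◇ x ≡ 𝟏
    ◇-b₁ : ∀ x → ◇ (◇ x · 𝟎) ≡ ◇ x · 𝟎
    ◇-b₂ : ◇ 𝟎 ≡ 𝟎
    ◇-c : ∀ x y → ◇ (((x · 𝟎) · (y · 𝟎)) · x) ≡ ((◇ x · 𝟎) · (◇ y · 𝟎)) · ◇ x

module Submission where

open import Defs
open import Level using (Level)
open import Relation.Binary.PropositionalEquality using (_≡_; sym; trans; cong; cong₂; module ≡-Reasoning)

-- Axiom (a), applied to x and to ◇x, gives ◇◇x · ◇x = 1 = ◇x · ◇◇x.  In any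
-- quasi-implication algebra x · y = y · x already
-- forces x = y: every x · x is a left unit, so axiom (3) reads x = y.

module QuasiImplicationAlgebraProperties
  {a : Level} {A : Set a} {_·_ : A → A → A}
  (isQIA : IsQuasiImplicationAlgebra A _·_) where

  open IsQuasiImplicationAlgebra isQIA
  open ≡-Reasoning

  x·[x·y]≡x·y : ∀ x y → x · (x · y) ≡ x · y
  x·[x·y]≡x·y x y = begin
    x · (x · y)                ≡⟨ cong (_· (x · y)) (sym (qi1 x y)) ⟩
    ((x · y) · x) · (x · y)    ≡⟨ qi1 (x · y) x ⟩
    x · y                      ∎

  [y·x]·[y·x]≡x·x : ∀ x y → (y · x) · (y · x) ≡ x · x
  [y·x]·[y·x]≡x·x x y = begin
    (y · x) · (y · x)                  ≡⟨ sym (qi2 x y x) ⟩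
    (x · y) · (x · x)                  ≡⟨ cong (_· (x · x)) (sym (x·[x·y]≡x·y x y)) ⟩
    (x · (x · y)) · (x · x)            ≡⟨ sym (qi2 (x · y) x x) ⟩
    ((x · y) · x) · ((x · y) · x)      ≡⟨ cong₂ _·_ (qi1 x y) (qi1 x y) ⟩
    x · x                              ∎

  x·x≡y·y : ∀ x y → x · x ≡ y · y
  x·x≡y·y x y = begin
    x · x              ≡⟨ sym ([y·x]·[y·x]≡x·x x p) ⟩
    (p · x) · (p · x)  ≡⟨ cong₂ _·_ (qi3 x y) (qi3 x y) ⟩
    (q · y) · (q · y)  ≡⟨ [y·x]·[y·x]≡x·x y q ⟩
    y · y              ∎
    where
    p q : A
    p = (x · y) · (y · x)
    q = (y · x) · (x · y)

  [x·x]·y≡y : ∀ x y → (x · x) · y ≡ y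
  [x·x]·y≡y x y = trans (cong (_· y) (x·x≡y·y x y)) (qi1 y y)

  x·y≡y·x⇒x≡y : ∀ {x y} → x · y ≡ y · x → x ≡ y
  x·y≡y·x⇒x≡y {x} {y} comm = begin
    x                              ≡⟨ sym ([x·x]·y≡y (x · y) x) ⟩
    ((x · y) · (x · y)) · x        ≡⟨ cong (λ u → ((x · y) · u) · x) comm ⟩
    ((x · y) · (y · x)) · x        ≡⟨ qi3 x y ⟩
    ((y · x) · (x · y)) · y        ≡⟨ cong (λ u → (u · (x · y)) · y) (sym comm) ⟩
    ((x · y) · (x · y)) · y        ≡⟨ [x·x]·y≡y (x · y) y ⟩
    y                              ∎

proposition4p3 : {a : Level} (M : MonadicQIA a) → (x : MonadicQIA.Carrier M) → MonadicQIA.◇ M (MonadicQIA.◇ M x) ≡ MonadicQIA.◇ M x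
proposition4p3 M x = x·y≡y·x⇒x≡y (trans (◇-a₁ x) (sym (◇-a₂ (◇ x))))
  where
  open MonadicQIA M
  open QuasiImplicationAlgebraProperties isQIA
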